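{- Let $(h_n)_{n\ge 0}$ and $(j_r)_{r\ge 1}$ be sequences of complex numbers with $h_0=1$ satisfying \[ n\,h_n=\sum_{r=1}^{n} j_r\,h_{n-r}\qquad\text{for all } n\ge 1 . \] For $n\ge 1$ let $J_n$ be the $n\times n$ matrix \[ J_n=\begin{pmatrix} j_1 & -1 & 0 & \cdots & 0 \\ j_2 & j_1 & -2 & \cdots & 0 \\ \vdots & \vdots & \vdots & \ddots & \vdots \\ j_{n-1} & j_{n-2} & \cdots & j_1 & -(n-1)\\ j_n & j_{n-1} & \cdots & j_2 & j_1 \end{pmatrix}, \] i.e. the $(i,k)$ entry is $j_{i-k+1}$ if $k\le i$, is $-i$ if $k=i+1$, and is $0$ if $k>i+1$. Then the characteristic polynomial $\chi(J_n)(x)=\det(xI_n-J_n)$ satisfies \[ \chi(J_n)(x)=\sum_{r=0}^{n}\binom{n}{r}\, r!\, h_r\,(-1)^r\,x^{\,n-r}. \]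
   Context: $I_n$ denotes the $n\times n$ identity matrix and $\chi(M)(x)=\det(xI_n-M)$ denotes the characteristic polynomial of an $n\times n$ matrix $M$. The convention $0!\,h_0=1$ is used for the $r=0$ term. -}

module Defs where

open import Level using (_⊔_)
open import Algebra.Bundles using (CommutativeRing)
open import Data.Nat as ℕ using (ℕ; zero; suc; _∸_; _≤?_; _≟_; _!)
open import Data.Nat.Combinatorics using (_C_)
open import Data.Fin using (Fin; toℕ; punchIn)
import Data.Fin as Fin
open import Relation.Nullary using (yes; no)

module _ {c ℓ} (R : CommutativeRing c ℓ) where
  open CommutativeRing R

  fromℕ : ℕ → Carrier
  fromℕ zero    = 0#
  fromℕ (suc n) = 1# + fromℕ n

  pow : Carrier → ℕ → Carrier
  pow x zero    = 1#
  pow x (suc n) = x * pow x n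

  sgn : ℕ → Carrier
  sgn zero    = 1#
  sgn (suc n) = - sgn n

  sumBelow : (ℕ → Carrier) → ℕ → Carrier
  sumBelow f zero    = 0#
  sumBelow f (suc n) = sumBelow f n + f n

  sumFin : ∀ n → (Fin n → Carrier) → Carrier
  sumFin zero    f = 0#
  sumFin (suc n) f = f Fin.zero + sumFin n (λ k → f (Fin.suc k))

  det : ∀ n → (Fin n → Fin n → Carrier) → Carrier
  det zero    M = 1#
  det (suc n) M =
    sumFin (suc n) (λ k → sgn (toℕ k) * (M Fin.zero k * det n (λ a b → M (Fin.suc a) (punchIn k b))))

  xI-M : ∀ n → Carrier → (Fin n → Fin n → Carrier) → (Fin n → Fin n → Carrier)
  xI-M n x M a b with toℕ a ≟ toℕ b
  ... | yes _ = x - M a b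
  ... | no  _ = - M a b

  charPolyAt : ∀ n → (Fin n → Fin n → Carrier) → Carrier → Carrier
  charPolyAt n M x = det n (xI-M n x M)

  -- the matrix J_n (0-indexed a,b correspond to 1-indexed i = a+1, k = b+1):
  --   k ≤ i      ↦ j_{i-k+1}
  --   k = i + 1  ↦ -i
  --   otherwise  ↦ 0
  Jmat : (j : ℕ → Carrier) → ∀ n → Fin n → Fin n → Carrier
  Jmat j n a b with toℕ b ≤? toℕ a
  ... | yes _ = j (suc (toℕ a ∸ toℕ b))
  ... | no  _ with toℕ b ≟ suc (toℕ a)
  ...   | yes _ = - fromℕ (suc (toℕ a))
  ...   | no  _ = 0#

  NewtonRel : (h j : ℕ → Carrier) → Set ℓ
  NewtonRel h j = ∀ n → fromℕ (suc n) * h (suc n) ≈ sumBelow (λ r → j (suc r) * h (suc n ∸ suc r)) (suc n)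

  rhs : (h : ℕ → Carrier) → ℕ → Carrier → Carrier
  rhs h n x = sumBelow (λ r → fromℕ ((n C r) ℕ.* (r !)) * (h r * (sgn r * pow x (n ∸ r)))) (suc n)

{-# OPTIONS --safe #-}
-- xI − J is lower Hessenberg: Toeplitz on and below the diagonal with first column c₀ = x − j₁,
-- c_d = −j_{d+1}, and with superdiagonal 1, 2, 3, … . For a lower Hessenberg B the first-row
-- expansion gives the first-column expansion of the leading minors D_m, and re-summing that along
-- antidiagonals gives the last-row recurrence
--   D_{m+1} = Σ_{l ≤ m} D_l · (−1)^{m−l} B_{l,l+1} ⋯ B_{m−1,m} · B_{m,l}.
-- For xI − J it reads D_{m+1} + Σ_l D_l (−1)^{m−l} (l+1)⋯m j_{m−l+1} = x D_m.
-- The right-hand side is T_m = Σ_s h_s (−1)^s (d/dx)^s x^m, so the Leibniz rule for x · x^m gives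
-- T_{m+1} = x T_m − Σ_s (s+1) h_{s+1} (−1)^s (d/dx)^s x^m; expanding (s+1) h_{s+1} by the Newton
-- relation and re-summing gives the same recurrence. Both sequences start at 1, so they agree.
module Submission where

open import Defs
open import Algebra.Bundles using (CommutativeRing)
open import Data.Nat using (ℕ; zero; suc; _∸_; _<_; _≤_; s≤s; z≤n)
import Data.Nat as ℕ
import Data.Nat.Properties as ℕ
open import Data.Nat.Combinatorics using (_C_)
open import Data.Nat.Induction using (<-rec)
open import Data.Fin using (Fin; toℕ; punchIn)
import Data.Fin as Fin
import Level
open import Function using (_∘_)
open import Relation.Binary.PropositionalEquality as ≡ using (_≡_)
open import Relation.Nullary using (yes; no; contradiction)

module _ where
  open import Data.Nat using (_+_; _*_; _!)
  open import Data.Nat.Combinatorics using (nCk+nC[k+1]≡[n+1]C[k+1])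
  open import Data.Nat.Properties
  open import Data.Nat.Tactic.RingSolver using (solve-∀)
  open import Algebra.Properties.CommutativeSemigroup *-commutativeSemigroup using (xy∙z≈y∙xz)
  open ≡ using (refl; sym; trans; cong; cong₂; module ≡-Reasoning)

  falling : ℕ → ℕ → ℕ
  falling n       zero    = 1
  falling zero    (suc r) = 0
  falling (suc n) (suc r) = suc n * falling n r

  rising : ℕ → ℕ → ℕ
  rising a zero    = 1
  rising a (suc k) = suc a * rising (suc a) k

  falling-pascal : ∀ m s → falling (suc m) (suc s) ≡ falling m (suc s) + suc s * falling m s
  falling-pascal zero    zero    = refl
  falling-pascal zero    (suc s) = sym (*-zeroʳ (suc (suc s)))
  falling-pascal (suc m) zero    = +-comm 1 (suc m * 1)
  falling-pascal (suc m) (suc s) = begin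
    suc (suc m) * (suc m * F)             ≡⟨ split m F ⟩
    suc m * (suc m * F) + suc m * F       ≡⟨ cong (λ y → suc m * y + suc m * F) (falling-pascal m s) ⟩
    suc m * (G + suc s * F) + suc m * F   ≡⟨ regroup m s F G ⟩
    suc m * G + suc (suc s) * (suc m * F) ∎
    where
    open ≡-Reasoning
    F = falling m s
    G = falling m (suc s)
    split : ∀ m F → suc (suc m) * (suc m * F) ≡ suc m * (suc m * F) + suc m * F
    split = solve-∀
    regroup : ∀ m s F G → suc m * (G + suc s * F) + suc m * F ≡ suc m * G + suc (suc s) * (suc m * F)
    regroup = solve-∀

  binomial*factorial≡falling : ∀ n r → (n C r) * r ! ≡ falling n r
  binomial*factorial≡falling n       zero    = refl
  binomial*factorial≡falling zero    (suc r) = refl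
  binomial*factorial≡falling (suc n) (suc r) = begin
    (suc n C suc r) * (suc r * r !)                       ≡⟨ cong (_* (suc r * r !)) (nCk+nC[k+1]≡[n+1]C[k+1] n r) ⟨
    (n C r + n C suc r) * (suc r * r !)                   ≡⟨ regroup (n C r) (n C suc r) r (r !) ⟩
    (n C suc r) * (suc r * r !) + suc r * ((n C r) * r !)
      ≡⟨ cong₂ (λ a b → a + suc r * b) (binomial*factorial≡falling n (suc r)) (binomial*factorial≡falling n r) ⟩
    falling n (suc r) + suc r * falling n r               ≡⟨ falling-pascal n r ⟨
    falling (suc n) (suc r)                               ∎
    where
    open ≡-Reasoning
    regroup : ∀ a b r f → (a + b) * (suc r * f) ≡ b * (suc r * f) + suc r * (a * f)
    regroup = solve-∀

  falling-vanishes : ∀ {m r} → m < r → falling m r ≡ 0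
  falling-vanishes {zero}  {suc r} _         = refl
  falling-vanishes {suc m} {suc r} (s≤s m<r) = trans (cong (suc m *_) (falling-vanishes m<r)) (*-zeroʳ (suc m))

  rising*falling : ∀ l t q → rising l t * falling l q ≡ falling (l + t) (t + q)
  rising*falling l zero    q = trans (+-identityʳ (falling l q)) (cong (λ n → falling n q) (sym (+-identityʳ l)))
  rising*falling l (suc t) q = begin
    suc l * rising (suc l) t * falling l q     ≡⟨ xy∙z≈y∙xz (suc l) (rising (suc l) t) (falling l q) ⟩
    rising (suc l) t * falling (suc l) (suc q) ≡⟨ rising*falling (suc l) t (suc q) ⟩
    falling (suc l + t) (t + suc q)            ≡⟨ cong₂ falling (sym (+-suc l t)) (+-suc t q) ⟩
    falling (l + suc t) (suc t + q)            ∎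
    where open ≡-Reasoning

module _ {c ℓ} (R : CommutativeRing c ℓ) where
  open CommutativeRing R
  open import Algebra.Properties.Ring ring
    using (-‿distribˡ-*; -1*x≈-x; -0#≈0#; -‿+-comm; -‿involutive; +-cancelʳ)
  open import Algebra.Properties.CommutativeSemigroup +-commutativeSemigroup using (interchange)
  open import Algebra.Properties.CommutativeSemigroup *-commutativeSemigroup using (x∙yz≈y∙xz)
  open import Algebra.Properties.Semiring.Mult semiring using (_×_; ×-homo-+; ×1-homo-*)
  open import Algebra.Solver.Ring.NaturalCoefficients.Default commutativeSemiring
    using (solve; _:=_; _:*_; _:+_)
  open import Relation.Binary.Reasoning.Setoid setoid

  private
    ∑ : (ℕ → Carrier) → ℕ → Carrier
    ∑ = sumBelow R

    −1^_ : ℕ → Carrier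
    −1^_ = sgn R

    ι : ℕ → Carrier
    ι = fromℕ R

  ι≡×1 : ∀ n → ι n ≡ n × 1#
  ι≡×1 zero    = ≡.refl
  ι≡×1 (suc n) = ≡.cong (1# +_) (ι≡×1 n)

  ι-+ : ∀ m n → ι (m ℕ.+ n) ≈ ι m + ι n
  ι-+ m n rewrite ι≡×1 (m ℕ.+ n) | ι≡×1 m | ι≡×1 n = ×-homo-+ 1# m n

  ι-* : ∀ m n → ι (m ℕ.* n) ≈ ι m * ι n
  ι-* m n rewrite ι≡×1 (m ℕ.* n) | ι≡×1 m | ι≡×1 n = ×1-homo-* m n

  −1^-+ : ∀ p q → −1^ (p ℕ.+ q) ≈ −1^ p * −1^ q
  −1^-+ zero    q = sym (*-identityˡ _)
  −1^-+ (suc p) q = trans (-‿cong (−1^-+ p q)) (-‿distribˡ-* _ _)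

  ∑-cong : ∀ n {f g : ℕ → Carrier} → (∀ k → k < n → f k ≈ g k) → ∑ f n ≈ ∑ g n
  ∑-cong zero    f≈g = refl
  ∑-cong (suc n) f≈g = +-cong (∑-cong n (λ k k<n → f≈g k (ℕ.m<n⇒m<1+n k<n))) (f≈g n ℕ.≤-refl)

  ∑-zero : ∀ n {f : ℕ → Carrier} → (∀ k → k < n → f k ≈ 0#) → ∑ f n ≈ 0#
  ∑-zero zero    f≈0 = refl
  ∑-zero (suc n) f≈0 =
    trans (+-cong (∑-zero n (λ k k<n → f≈0 k (ℕ.m<n⇒m<1+n k<n))) (f≈0 n ℕ.≤-refl)) (+-identityˡ 0#)

  ∑-first : ∀ n (f : ℕ → Carrier) → ∑ f (suc n) ≈ f 0 + ∑ (λ k → f (suc k)) n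
  ∑-first zero    f = trans (+-identityˡ _) (sym (+-identityʳ _))
  ∑-first (suc n) f = trans (+-congʳ (∑-first n f)) (+-assoc _ _ _)

  ∑-distrib-+ : ∀ n (f g : ℕ → Carrier) → ∑ (λ k → f k + g k) n ≈ ∑ f n + ∑ g n
  ∑-distrib-+ zero    f g = sym (+-identityˡ _)
  ∑-distrib-+ (suc n) f g = trans (+-congʳ (∑-distrib-+ n f g)) (interchange _ _ _ _)

  *-distribˡ-∑ : ∀ n a (f : ℕ → Carrier) → a * ∑ f n ≈ ∑ (λ k → a * f k) n
  *-distribˡ-∑ zero    a f = zeroʳ a
  *-distribˡ-∑ (suc n) a f = trans (distribˡ _ _ _) (+-congʳ (*-distribˡ-∑ n a f))

  *-distribʳ-∑ : ∀ n a (f : ℕ → Carrier) → ∑ f n * a ≈ ∑ (λ k → f k * a) n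
  *-distribʳ-∑ n a f =
    trans (*-comm _ a) (trans (*-distribˡ-∑ n a f) (∑-cong n (λ k _ → *-comm a (f k))))

  -‿distrib-∑ : ∀ n (f : ℕ → Carrier) → - ∑ f n ≈ ∑ (λ k → - f k) n
  -‿distrib-∑ zero    f = -0#≈0#
  -‿distrib-∑ (suc n) f = trans (sym (-‿+-comm _ _)) (+-congʳ (-‿distrib-∑ n f))

  ∑-reverse : ∀ n (f : ℕ → Carrier) → ∑ f n ≈ ∑ (λ t → f (n ∸ suc t)) n
  ∑-reverse zero    f = refl
  ∑-reverse (suc n) f = begin
    ∑ f n + f n                         ≈⟨ +-congʳ (∑-reverse n f) ⟩
    ∑ (λ t → f (n ∸ suc t)) n + f n     ≈⟨ +-comm _ _ ⟩
    f n + ∑ (λ t → f (n ∸ suc t)) n     ≈⟨ ∑-first n (λ t → f (suc n ∸ suc t)) ⟨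
    ∑ (λ t → f (suc n ∸ suc t)) (suc n) ∎

  ∑-antidiagonal : ∀ n (G : ℕ → ℕ → Carrier) →
    ∑ (λ t → ∑ (G t) (n ∸ t)) n ≈ ∑ (λ s → ∑ (λ t → G t (s ∸ t)) (suc s)) n
  ∑-antidiagonal zero    G = refl
  ∑-antidiagonal (suc n) G = begin
    ∑ (λ t → ∑ (G t) (suc n ∸ t)) (suc n)
      ≈⟨ ∑-cong (suc n) (λ t t≤n → reflexive (≡.cong (∑ (G t)) (ℕ.+-∸-assoc 1 (ℕ.≤-pred t≤n)))) ⟩
    ∑ (λ t → ∑ (G t) (n ∸ t) + G t (n ∸ t)) (suc n)
      ≈⟨ ∑-distrib-+ (suc n) _ _ ⟩
    (∑ (λ t → ∑ (G t) (n ∸ t)) n + ∑ (G n) (n ∸ n)) + ∑ (λ t → G t (n ∸ t)) (suc n)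
      ≈⟨ +-congʳ (+-cong (∑-antidiagonal n G) (reflexive (≡.cong (∑ (G n)) (ℕ.n∸n≡0 n)))) ⟩
    (∑ (λ s → ∑ (λ t → G t (s ∸ t)) (suc s)) n + 0#) + ∑ (λ t → G t (n ∸ t)) (suc n)
      ≈⟨ +-congʳ (+-identityʳ _) ⟩
    ∑ (λ s → ∑ (λ t → G t (s ∸ t)) (suc s)) (suc n) ∎

  sumFin-cong : ∀ n {f g : Fin n → Carrier} → (∀ k → f k ≈ g k) → sumFin R n f ≈ sumFin R n g
  sumFin-cong zero    f≈g = refl
  sumFin-cong (suc n) f≈g = +-cong (f≈g Fin.zero) (sumFin-cong n (λ k → f≈g (Fin.suc k)))

  sumFin-zero : ∀ n {f : Fin n → Carrier} → (∀ k → f k ≈ 0#) → sumFin R n f ≈ 0#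
  sumFin-zero zero    f≈0 = refl
  sumFin-zero (suc n) f≈0 =
    trans (+-cong (f≈0 Fin.zero) (sumFin-zero n (λ k → f≈0 (Fin.suc k)))) (+-identityˡ 0#)

  det-cong : ∀ n {M N : Fin n → Fin n → Carrier} → (∀ p q → M p q ≈ N p q) → det R n M ≈ det R n N
  det-cong zero    M≈N = refl
  det-cong (suc n) M≈N = sumFin-cong (suc n) λ k →
    *-congˡ {−1^ toℕ k} (*-cong (M≈N Fin.zero k) (det-cong n (λ p q → M≈N (Fin.suc p) (punchIn k q))))

  det-firstRowTwoTerms : ∀ m (M : Fin (suc (suc m)) → Fin (suc (suc m)) → Carrier) →
    (∀ k → M Fin.zero (Fin.suc (Fin.suc k)) ≈ 0#) →
    det R (suc (suc m)) M
      ≈ M Fin.zero Fin.zero * det R (suc m) (λ p q → M (Fin.suc p) (Fin.suc q))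
        - M Fin.zero (Fin.suc Fin.zero) * det R (suc m) (λ p q → M (Fin.suc p) (punchIn (Fin.suc Fin.zero) q))
  det-firstRowTwoTerms m M row₀-vanishes = +-cong (*-identityˡ _) (begin
    - 1# * (M₀₁ * minor₀₁) + rest ≈⟨ +-cong (-1*x≈-x _) rest≈0 ⟩
    - (M₀₁ * minor₀₁) + 0#        ≈⟨ +-identityʳ _ ⟩
    - (M₀₁ * minor₀₁)             ∎)
    where
    M₀₁ = M Fin.zero (Fin.suc Fin.zero)
    minor₀₁ = det R (suc m) (λ p q → M (Fin.suc p) (punchIn (Fin.suc Fin.zero) q))
    rest = sumFin R m (λ k → −1^ toℕ (Fin.suc (Fin.suc k))
             * (M Fin.zero (Fin.suc (Fin.suc k)) * det R (suc m) (λ p q → M (Fin.suc p) (punchIn (Fin.suc (Fin.suc k)) q))))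
    rest≈0 : rest ≈ 0#
    rest≈0 = sumFin-zero m λ k → trans (*-congˡ (trans (*-congʳ (row₀-vanishes k)) (zeroˡ _))) (zeroʳ _)

  Matrix : Set c
  Matrix = ℕ → ℕ → Carrier

  leadingMinor : Matrix → ℕ → Carrier
  leadingMinor B n = det R n (λ p q → B (toℕ p) (toℕ q))

  withFirstColumn : (ℕ → Carrier) → Matrix → Matrix
  withFirstColumn u B i zero    = u i
  withFirstColumn u B i (suc k) = B i (suc k)

  shift : Matrix → Matrix
  shift B i k = B (suc i) (suc k)

  shiftBy : ℕ → Matrix → Matrix
  shiftBy zero    B = B
  shiftBy (suc n) B = shiftBy n (shift B)

  shiftBy-+ : ∀ m n B → shiftBy (m ℕ.+ n) B ≡ shiftBy n (shiftBy m B)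
  shiftBy-+ zero    n B = ≡.refl
  shiftBy-+ (suc m) n B = shiftBy-+ m n (shift B)

  IsLowerHessenberg : Matrix → Set ℓ
  IsLowerHessenberg B = ∀ i k → suc i < k → B i k ≈ 0#

  shiftBy-isLowerHessenberg : ∀ n {B} → IsLowerHessenberg B → IsLowerHessenberg (shiftBy n B)
  shiftBy-isLowerHessenberg zero    isH = isH
  shiftBy-isLowerHessenberg (suc n) isH =
    shiftBy-isLowerHessenberg n (λ i k i+1<k → isH (suc i) (suc k) (s≤s i+1<k))

  superdiagonalProduct : Matrix → ℕ → Carrier
  superdiagonalProduct B zero    = 1#
  superdiagonalProduct B (suc k) = B 0 1 * superdiagonalProduct (shift B) k

  hook : Matrix → ℕ → Carrier
  hook B d = −1^ d * superdiagonalProduct B d * B d 0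

  withFirstColumn-firstRowExpansion : ∀ {B} → IsLowerHessenberg B → ∀ u m →
    leadingMinor (withFirstColumn u B) (suc (suc m))
      ≈ u 0 * leadingMinor (shift B) (suc m)
        - B 0 1 * leadingMinor (withFirstColumn (u ∘ suc) (shift B)) (suc m)
  withFirstColumn-firstRowExpansion {B} isH u m =
    trans (det-firstRowTwoTerms m (λ p q → withFirstColumn u B (toℕ p) (toℕ q))
                                  (λ k → isH 0 (suc (suc (toℕ k))) (s≤s (s≤s z≤n))))
          (+-congˡ (-‿cong (*-congˡ (det-cong (suc m) minor₀₁))))
    where
    minor₀₁ : ∀ p q → withFirstColumn u B (suc (toℕ p)) (toℕ (punchIn (Fin.suc Fin.zero) q))
                    ≈ withFirstColumn (u ∘ suc) (shift B) (toℕ p) (toℕ q)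
    minor₀₁ p Fin.zero    = refl
    minor₀₁ p (Fin.suc q) = refl

  withFirstColumn-firstColumnExpansion : ∀ {B} → IsLowerHessenberg B → ∀ u m →
    leadingMinor (withFirstColumn u B) (suc m)
      ≈ ∑ (λ k → −1^ k * superdiagonalProduct B k * u k * leadingMinor (shiftBy (suc k) B) (m ∸ k)) (suc m)
  withFirstColumn-firstColumnExpansion isH u zero = begin
    1# * (u 0 * 1#) + 0#    ≈⟨ trans (+-identityʳ _) (*-identityˡ _) ⟩
    u 0 * 1#                ≈⟨ *-congʳ (sym (trans (*-congʳ (*-identityˡ 1#)) (*-identityˡ (u 0)))) ⟩
    1# * 1# * u 0 * 1#      ≈⟨ +-identityˡ _ ⟨
    0# + 1# * 1# * u 0 * 1# ∎
  withFirstColumn-firstColumnExpansion {B} isH u (suc m) = begin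
    leadingMinor (withFirstColumn u B) (suc (suc m))
      ≈⟨ withFirstColumn-firstRowExpansion isH u m ⟩
    u 0 * leadingMinor (shift B) (suc m) - B 0 1 * leadingMinor (withFirstColumn (u ∘ suc) (shift B)) (suc m)
      ≈⟨ +-congˡ (-‿cong (*-congˡ (withFirstColumn-firstColumnExpansion (shiftBy-isLowerHessenberg 1 isH) (u ∘ suc) m))) ⟩
    u 0 * leadingMinor (shift B) (suc m) - B 0 1 * ∑ term (suc m)
      ≈⟨ +-cong (sym (trans (*-congʳ (*-congʳ (*-identityˡ 1#))) (*-congʳ (*-identityˡ (u 0)))))
                (trans (-‿cong (*-distribˡ-∑ (suc m) (B 0 1) term))
                  (trans (-‿distrib-∑ (suc m) _) (∑-cong (suc m) (λ k _ → absorb k)))) ⟩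
    1# * 1# * u 0 * leadingMinor (shift B) (suc m)
      + ∑ (λ k → −1^ suc k * superdiagonalProduct B (suc k) * u (suc k) * leadingMinor (shiftBy (suc (suc k)) B) (m ∸ k)) (suc m)
      ≈⟨ ∑-first (suc m) _ ⟨
    ∑ (λ k → −1^ k * superdiagonalProduct B k * u k * leadingMinor (shiftBy (suc k) B) (suc m ∸ k)) (suc (suc m)) ∎
    where
    term : ℕ → Carrier
    term k = −1^ k * superdiagonalProduct (shift B) k * u (suc k) * leadingMinor (shiftBy (suc k) (shift B)) (m ∸ k)
    rearrange : ∀ b s p y z → b * (s * p * y * z) ≈ s * (b * p) * y * z
    rearrange = solve 5 (λ b s p y z → b :* (s :* p :* y :* z) := s :* (b :* p) :* y :* z) refl
    absorb : ∀ k → - (B 0 1 * term k)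
      ≈ −1^ suc k * superdiagonalProduct B (suc k) * u (suc k) * leadingMinor (shiftBy (suc (suc k)) B) (m ∸ k)
    absorb k = trans (-‿cong (rearrange _ _ _ _ _))
      (trans (-‿distribˡ-* _ _) (*-congʳ (trans (-‿distribˡ-* _ _) (*-congʳ (-‿distribˡ-* _ _)))))

  leadingMinor-firstColumnExpansion : ∀ {B} → IsLowerHessenberg B → ∀ m →
    leadingMinor B (suc m) ≈ ∑ (λ k → hook B k * leadingMinor (shiftBy (suc k) B) (m ∸ k)) (suc m)
  leadingMinor-firstColumnExpansion {B} isH m =
    trans (det-cong (suc m) firstColumn-unchanged) (withFirstColumn-firstColumnExpansion isH (λ i → B i 0) m)
    where
    firstColumn-unchanged : ∀ p q → B (toℕ p) (toℕ q) ≈ withFirstColumn (λ i → B i 0) B (toℕ p) (toℕ q)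
    firstColumn-unchanged p Fin.zero    = refl
    firstColumn-unchanged p (Fin.suc q) = refl

  shiftBy-shiftBy : ∀ {k s} B → k ≤ s → shiftBy (s ∸ k) (shiftBy (suc k) B) ≡ shiftBy (suc s) B
  shiftBy-shiftBy {k} {s} B k≤s =
    ≡.trans (≡.sym (shiftBy-+ (suc k) (s ∸ k) B)) (≡.cong (λ n → shiftBy (suc n) B) (ℕ.m+[n∸m]≡n k≤s))

  -- Expand along the first column, expand each trailing minor along its last row by induction and
  -- re-sum along antidiagonals: the inner sums are first-column expansions of smaller leading minors.
  leadingMinor-lastRowExpansion : ∀ m {B} → IsLowerHessenberg B →
    leadingMinor B (suc m) ≈ ∑ (λ l → leadingMinor B l * hook (shiftBy l B) (m ∸ l)) (suc m)
  leadingMinor-lastRowExpansion = <-rec LastRowExpansion step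
    where
    LastRowExpansion : ℕ → Set (c Level.⊔ ℓ)
    LastRowExpansion m = ∀ {B} → IsLowerHessenberg B →
      leadingMinor B (suc m) ≈ ∑ (λ l → leadingMinor B l * hook (shiftBy l B) (m ∸ l)) (suc m)

    step : ∀ m → (∀ {m′} → m′ < m → LastRowExpansion m′) → LastRowExpansion m
    step m ih {B} isH = begin
      leadingMinor B (suc m)
        ≈⟨ leadingMinor-firstColumnExpansion isH m ⟩
      ∑ (λ k → hook B k * leadingMinor (shiftBy (suc k) B) (m ∸ k)) m
        + hook B m * leadingMinor (shiftBy (suc m) B) (m ∸ m)
        ≈⟨ +-cong (∑-cong m expand) lastTerm ⟩
      ∑ (λ k → ∑ (G k) (m ∸ k)) m + hook B m
        ≈⟨ +-congʳ (∑-antidiagonal m G) ⟩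
      ∑ (λ s → ∑ (λ k → G k (s ∸ k)) (suc s)) m + hook B m
        ≈⟨ +-cong (∑-cong m collect) (sym (*-identityˡ _)) ⟩
      ∑ (λ s → leadingMinor B (suc s) * hook (shiftBy (suc s) B) (m ∸ suc s)) m + 1# * hook B m
        ≈⟨ trans (+-comm _ _) (sym (∑-first m _)) ⟩
      ∑ (λ l → leadingMinor B l * hook (shiftBy l B) (m ∸ l)) (suc m) ∎
      where
      G : ℕ → ℕ → Carrier
      G k p = hook B k * (leadingMinor (shiftBy (suc k) B) p * hook (shiftBy p (shiftBy (suc k) B)) (m ∸ suc k ∸ p))

      lastTerm : hook B m * leadingMinor (shiftBy (suc m) B) (m ∸ m) ≈ hook B m
      lastTerm = trans (reflexive (≡.cong (λ n → hook B m * leadingMinor (shiftBy (suc m) B) n) (ℕ.n∸n≡0 m)))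
                       (*-identityʳ _)

      expand : ∀ k → k < m → hook B k * leadingMinor (shiftBy (suc k) B) (m ∸ k) ≈ ∑ (G k) (m ∸ k)
      expand k k<m = begin
        hook B k * leadingMinor (shiftBy (suc k) B) (m ∸ k)
          ≡⟨ ≡.cong (λ n → hook B k * leadingMinor (shiftBy (suc k) B) n) m∸k≡1+d ⟩
        hook B k * leadingMinor (shiftBy (suc k) B) (suc (m ∸ suc k))
          ≈⟨ *-congˡ (ih (ℕ.∸-monoʳ-< {m} {suc k} {0} (s≤s z≤n) k<m) (shiftBy-isLowerHessenberg (suc k) isH)) ⟩
        hook B k * ∑ (λ p → leadingMinor (shiftBy (suc k) B) p * hook (shiftBy p (shiftBy (suc k) B)) (m ∸ suc k ∸ p)) (suc (m ∸ suc k))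
          ≈⟨ *-distribˡ-∑ (suc (m ∸ suc k)) (hook B k) _ ⟩
        ∑ (G k) (suc (m ∸ suc k))
          ≡⟨ ≡.cong (∑ (G k)) m∸k≡1+d ⟨
        ∑ (G k) (m ∸ k) ∎
        where
        m∸k≡1+d : m ∸ k ≡ suc (m ∸ suc k)
        m∸k≡1+d = ℕ.+-∸-assoc 1 k<m

      collect : ∀ s → s < m →
        ∑ (λ k → G k (s ∸ k)) (suc s) ≈ leadingMinor B (suc s) * hook (shiftBy (suc s) B) (m ∸ suc s)
      collect s _ = begin
        ∑ (λ k → G k (s ∸ k)) (suc s)
          ≈⟨ ∑-cong (suc s) (λ k k≤s →
               trans (sym (*-assoc _ _ _)) (*-congˡ (reflexive (reindex (ℕ.≤-pred k≤s))))) ⟩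
        ∑ (λ k → hook B k * leadingMinor (shiftBy (suc k) B) (s ∸ k) * hook (shiftBy (suc s) B) (m ∸ suc s)) (suc s)
          ≈⟨ *-distribʳ-∑ (suc s) _ _ ⟨
        ∑ (λ k → hook B k * leadingMinor (shiftBy (suc k) B) (s ∸ k)) (suc s) * hook (shiftBy (suc s) B) (m ∸ suc s)
          ≈⟨ *-congʳ (leadingMinor-firstColumnExpansion isH s) ⟨
        leadingMinor B (suc s) * hook (shiftBy (suc s) B) (m ∸ suc s) ∎
        where
        reindex : ∀ {k} → k ≤ s → hook (shiftBy (s ∸ k) (shiftBy (suc k) B)) (m ∸ suc k ∸ (s ∸ k))
                                  ≡ hook (shiftBy (suc s) B) (m ∸ suc s)
        reindex {k} k≤s = ≡.cong₂ hook (shiftBy-shiftBy B k≤s)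
          (≡.trans (ℕ.∸-+-assoc m (suc k) (s ∸ k)) (≡.cong (λ n → m ∸ suc n) (ℕ.m+[n∸m]≡n k≤s)))

  module _ (column : ℕ → Carrier) where

    -- Entry (i, k) is column (i ∸ k) for k ≤ i, a + i + 1 for k = i + 1 and 0 beyond. The offset a
    -- makes shift (toeplitzHessenberg a) and toeplitzHessenberg (suc a) definitionally equal.
    toeplitzHessenberg : ℕ → Matrix
    toeplitzHessenberg a i       zero          = column i
    toeplitzHessenberg a zero    (suc zero)    = ι (suc a)
    toeplitzHessenberg a zero    (suc (suc k)) = 0#
    toeplitzHessenberg a (suc i) (suc k)       = toeplitzHessenberg (suc a) i k

    toeplitzHessenberg-isLowerHessenberg : ∀ a → IsLowerHessenberg (toeplitzHessenberg a)
    toeplitzHessenberg-isLowerHessenberg a zero    (suc zero)    (s≤s ())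
    toeplitzHessenberg-isLowerHessenberg a zero    (suc (suc k)) _           = refl
    toeplitzHessenberg-isLowerHessenberg a (suc i) (suc k)       (s≤s i+1<k) =
      toeplitzHessenberg-isLowerHessenberg (suc a) i k i+1<k

    toeplitzHessenberg-lower : ∀ a {i k} → k ≤ i → toeplitzHessenberg a i k ≡ column (i ∸ k)
    toeplitzHessenberg-lower a {k = zero}      _         = ≡.refl
    toeplitzHessenberg-lower a {suc i} {suc k} (s≤s k≤i) = toeplitzHessenberg-lower (suc a) k≤i

    toeplitzHessenberg-superdiagonal : ∀ a i → toeplitzHessenberg a i (suc i) ≡ ι (suc (a ℕ.+ i))
    toeplitzHessenberg-superdiagonal a zero    = ≡.cong (ι ∘ suc) (≡.sym (ℕ.+-identityʳ a))
    toeplitzHessenberg-superdiagonal a (suc i) =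
      ≡.trans (toeplitzHessenberg-superdiagonal (suc a) i) (≡.cong (ι ∘ suc) (≡.sym (ℕ.+-suc a i)))

    shiftBy-toeplitzHessenberg : ∀ n a → shiftBy n (toeplitzHessenberg a) ≡ toeplitzHessenberg (n ℕ.+ a)
    shiftBy-toeplitzHessenberg zero    a = ≡.refl
    shiftBy-toeplitzHessenberg (suc n) a =
      ≡.trans (shiftBy-toeplitzHessenberg n (suc a)) (≡.cong toeplitzHessenberg (ℕ.+-suc n a))

    superdiagonalProduct-toeplitzHessenberg : ∀ a k → superdiagonalProduct (toeplitzHessenberg a) k ≈ ι (rising a k)
    superdiagonalProduct-toeplitzHessenberg a zero    = sym (+-identityʳ 1#)
    superdiagonalProduct-toeplitzHessenberg a (suc k) =
      trans (*-congˡ (superdiagonalProduct-toeplitzHessenberg (suc a) k)) (sym (ι-* (suc a) (rising (suc a) k)))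

    hook-toeplitzHessenberg : ∀ l d → hook (shiftBy l (toeplitzHessenberg 0)) d ≈ −1^ d * ι (rising l d) * column d
    hook-toeplitzHessenberg l d rewrite shiftBy-toeplitzHessenberg l 0 | ℕ.+-identityʳ l =
      *-congʳ (*-congˡ (superdiagonalProduct-toeplitzHessenberg l d))

    toeplitzHessenberg-lastRowExpansion : ∀ m →
      leadingMinor (toeplitzHessenberg 0) (suc m)
        ≈ ∑ (λ l → leadingMinor (toeplitzHessenberg 0) l * (−1^ (m ∸ l) * ι (rising l (m ∸ l)) * column (m ∸ l))) (suc m)
    toeplitzHessenberg-lastRowExpansion m =
      trans (leadingMinor-lastRowExpansion m (toeplitzHessenberg-isLowerHessenberg 0))
            (∑-cong (suc m) (λ l _ → *-congˡ (hook-toeplitzHessenberg l (m ∸ l))))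

  module _ (x : Carrier) where

    private
      _^_ : Carrier → ℕ → Carrier
      _^_ = pow R

    -- the s-th derivative of xᵐ
    powDerivative : ℕ → ℕ → Carrier
    powDerivative m s = ι (falling m s) * x ^ (m ∸ s)

    powDerivative-suc-zero : ∀ m → powDerivative (suc m) 0 ≈ x * powDerivative m 0
    powDerivative-suc-zero m = x∙yz≈y∙xz (ι 1) x (x ^ m)

    powDerivative-vanishes : ∀ m → powDerivative m (suc m) ≈ 0#
    powDerivative-vanishes m rewrite falling-vanishes (ℕ.n<1+n m) = zeroˡ _

    x*powDerivative : ∀ m s → x * powDerivative m (suc s) ≈ ι (falling m (suc s)) * x ^ (m ∸ s)
    x*powDerivative m s with s ℕ.<? m
    ... | yes s<m = trans (x∙yz≈y∙xz x _ _)
                          (reflexive (≡.cong (λ e → ι (falling m (suc s)) * x ^ e) (≡.sym (ℕ.+-∸-assoc 1 s<m))))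
    ... | no  s≮m rewrite falling-vanishes (s≤s (ℕ.≮⇒≥ s≮m)) =
                    trans (*-congˡ (zeroˡ _)) (trans (zeroʳ x) (sym (zeroˡ _)))

    powDerivative-leibniz : ∀ m s →
      powDerivative (suc m) (suc s) ≈ x * powDerivative m (suc s) + ι (suc s) * powDerivative m s
    powDerivative-leibniz m s = begin
      ι (falling (suc m) (suc s)) * x ^ (m ∸ s)
        ≡⟨ ≡.cong (λ n → ι n * x ^ (m ∸ s)) (falling-pascal m s) ⟩
      ι (falling m (suc s) ℕ.+ suc s ℕ.* falling m s) * x ^ (m ∸ s)
        ≈⟨ *-congʳ (trans (ι-+ (falling m (suc s)) _) (+-congˡ (ι-* (suc s) (falling m s)))) ⟩
      (ι (falling m (suc s)) + ι (suc s) * ι (falling m s)) * x ^ (m ∸ s)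
        ≈⟨ trans (distribʳ _ _ _) (+-congˡ (*-assoc _ _ _)) ⟩
      ι (falling m (suc s)) * x ^ (m ∸ s) + ι (suc s) * powDerivative m s
        ≈⟨ +-congʳ (x*powDerivative m s) ⟨
      x * powDerivative m (suc s) + ι (suc s) * powDerivative m s ∎

    powDerivative-+ : ∀ l t p → powDerivative (l ℕ.+ t) (t ℕ.+ p) ≈ ι (rising l t) * powDerivative l p
    powDerivative-+ l t p = begin
      ι (falling (l ℕ.+ t) (t ℕ.+ p)) * x ^ (l ℕ.+ t ∸ (t ℕ.+ p))
        ≡⟨ ≡.cong₂ (λ n e → ι n * x ^ e) (≡.sym (rising*falling l t p))
                   (≡.trans (≡.cong (_∸ (t ℕ.+ p)) (ℕ.+-comm l t)) (ℕ.[m+n]∸[m+o]≡n∸o t l p)) ⟩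
      ι (rising l t ℕ.* falling l p) * x ^ (l ∸ p)
        ≈⟨ trans (*-congʳ (ι-* (rising l t) (falling l p))) (*-assoc _ _ _) ⟩
      ι (rising l t) * powDerivative l p ∎

    module _ (h : ℕ → Carrier) where

      rhsTerm : ℕ → ℕ → Carrier
      rhsTerm m s = h s * (−1^ s * powDerivative m s)

      rhsPoly : ℕ → Carrier
      rhsPoly m = ∑ (rhsTerm m) (suc m)

      rhs≈rhsPoly : ∀ m → rhs R h m x ≈ rhsPoly m
      rhs≈rhsPoly m = ∑-cong (suc m) λ r _ → begin
        ι ((m C r) ℕ.* (r ℕ.!)) * (h r * (−1^ r * x ^ (m ∸ r)))
          ≡⟨ ≡.cong (λ n → ι n * (h r * (−1^ r * x ^ (m ∸ r)))) (binomial*factorial≡falling m r) ⟩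
        ι (falling m r) * (h r * (−1^ r * x ^ (m ∸ r)))
          ≈⟨ trans (x∙yz≈y∙xz _ _ _) (*-congˡ (x∙yz≈y∙xz _ _ _)) ⟩
        rhsTerm m r ∎

      rhsPoly-zero : h 0 ≈ 1# → rhsPoly 0 ≈ 1#
      rhsPoly-zero h₀≈1 = begin
        0# + h 0 * (1# * (ι 1 * 1#)) ≈⟨ +-identityˡ _ ⟩
        h 0 * (1# * (ι 1 * 1#))      ≈⟨ *-cong h₀≈1 (trans (*-identityˡ _) (trans (*-identityʳ _) (+-identityʳ 1#))) ⟩
        1# * 1#                      ≈⟨ *-identityˡ 1# ⟩
        1#                           ∎

      rhsPoly-pascal : ∀ m →
        rhsPoly (suc m) + ∑ (λ s → ι (suc s) * h (suc s) * (−1^ s * powDerivative m s)) (suc m) ≈ x * rhsPoly m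
      rhsPoly-pascal m = begin
        rhsPoly (suc m) + ∑ N (suc m)
          ≈⟨ +-congʳ (∑-first (suc m) (rhsTerm (suc m))) ⟩
        (rhsTerm (suc m) 0 + ∑ (λ s → rhsTerm (suc m) (suc s)) (suc m)) + ∑ N (suc m)
          ≈⟨ trans (+-assoc _ _ _) (+-congˡ (sym (∑-distrib-+ (suc m) _ N))) ⟩
        rhsTerm (suc m) 0 + ∑ (λ s → rhsTerm (suc m) (suc s) + N s) (suc m)
          ≈⟨ +-cong first-term (∑-cong (suc m) (λ s _ → later-term s)) ⟩
        x * rhsTerm m 0 + ∑ (λ s → x * rhsTerm m (suc s)) (suc m)
          ≈⟨ trans (+-congˡ (sym (*-distribˡ-∑ (suc m) x _))) (sym (distribˡ x _ _)) ⟩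
        x * (rhsTerm m 0 + ∑ (λ s → rhsTerm m (suc s)) (suc m))
          ≈⟨ *-congˡ (∑-first (suc m) (rhsTerm m)) ⟨
        x * (rhsPoly m + rhsTerm m (suc m))
          ≈⟨ *-congˡ (trans (+-congˡ top-term) (+-identityʳ _)) ⟩
        x * rhsPoly m ∎
        where
        N : ℕ → Carrier
        N s = ι (suc s) * h (suc s) * (−1^ s * powDerivative m s)

        top-term : rhsTerm m (suc m) ≈ 0#
        top-term = trans (*-congˡ (trans (*-congˡ (powDerivative-vanishes m)) (zeroʳ _))) (zeroʳ _)

        first-term : rhsTerm (suc m) 0 ≈ x * rhsTerm m 0
        first-term = trans (*-congˡ (*-congˡ (powDerivative-suc-zero m)))
                           (trans (*-congˡ (x∙yz≈y∙xz _ x _)) (x∙yz≈y∙xz _ x _))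

        later-term : ∀ s → rhsTerm (suc m) (suc s) + N s ≈ x * rhsTerm m (suc s)
        later-term s = begin
          H * (- S * powDerivative (suc m) (suc s)) + f * H * (S * B)
            ≈⟨ +-congʳ (*-congˡ (*-congˡ (powDerivative-leibniz m s))) ⟩
          H * (- S * (x * A + f * B)) + f * H * (S * B)
            ≈⟨ +-congʳ (expand H (- S) x A f B) ⟩
          (x * (H * (- S * A)) + f * H * (- S * B)) + f * H * (S * B)
            ≈⟨ +-assoc _ _ _ ⟩
          x * (H * (- S * A)) + (f * H * (- S * B) + f * H * (S * B))
            ≈⟨ +-congˡ cancel ⟩
          x * (H * (- S * A)) + 0#
            ≈⟨ +-identityʳ _ ⟩
          x * rhsTerm m (suc s) ∎
          where
          H = h (suc s)
          S = −1^ s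
          f = ι (suc s)
          A = powDerivative m (suc s)
          B = powDerivative m s
          expand : ∀ H T x A f B → H * (T * (x * A + f * B)) ≈ x * (H * (T * A)) + f * H * (T * B)
          expand = solve 6 (λ H T x A f B → H :* (T :* (x :* A :+ f :* B)) := x :* (H :* (T :* A)) :+ f :* H :* (T :* B)) refl
          cancel : f * H * (- S * B) + f * H * (S * B) ≈ 0#
          cancel = begin
            f * H * (- S * B) + f * H * (S * B) ≈⟨ distribˡ _ _ _ ⟨
            f * H * (- S * B + S * B)           ≈⟨ *-congˡ (distribʳ B (- S) S) ⟨
            f * H * ((- S + S) * B)             ≈⟨ *-congˡ (trans (*-congʳ (-‿inverseˡ S)) (zeroˡ B)) ⟩
            f * H * 0#                          ≈⟨ zeroʳ _ ⟩
            0#                                  ∎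

    module _ (j : ℕ → Carrier) where

      diagonal : ℕ → Carrier
      diagonal zero    = x
      diagonal (suc d) = 0#

      charColumn : ℕ → Carrier
      charColumn d = diagonal d - j (suc d)

      charMatrix : Matrix
      charMatrix = toeplitzHessenberg charColumn 0

      charMatrix-diagonal : ∀ {i k} → i ≡ k → x - j (suc (i ∸ k)) ≈ charMatrix i k
      charMatrix-diagonal {i} ≡.refl
        rewrite toeplitzHessenberg-lower charColumn 0 (ℕ.≤-refl {i}) | ℕ.n∸n≡0 i = refl

      charMatrix-below : ∀ {i k} → k < i → - j (suc (i ∸ k)) ≈ charMatrix i k
      charMatrix-below {i} {k} k<i = begin
        - j (suc (i ∸ k))            ≡⟨ ≡.cong (λ d → - j (suc d)) i∸k≡1+d ⟩
        - j (suc (suc (i ∸ suc k)))  ≈⟨ +-identityˡ _ ⟨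
        charColumn (suc (i ∸ suc k)) ≡⟨ ≡.cong charColumn i∸k≡1+d ⟨
        charColumn (i ∸ k)           ≡⟨ toeplitzHessenberg-lower charColumn 0 (ℕ.<⇒≤ k<i) ⟨
        charMatrix i k               ∎
        where
        i∸k≡1+d : i ∸ k ≡ suc (i ∸ suc k)
        i∸k≡1+d = ℕ.+-∸-assoc 1 k<i

      charMatrix-superdiagonal : ∀ {i k} → k ≡ suc i → - (- ι (suc i)) ≈ charMatrix i k
      charMatrix-superdiagonal {i} ≡.refl =
        trans (-‿involutive _) (reflexive (≡.sym (toeplitzHessenberg-superdiagonal charColumn 0 i)))

      xI-J≈charMatrix : ∀ n (p q : Fin n) → xI-M R n x (Jmat R j n) p q ≈ charMatrix (toℕ p) (toℕ q)
      xI-J≈charMatrix n p q with toℕ p ℕ.≟ toℕ q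
      ... | yes p≡q with toℕ q ℕ.≤? toℕ p
      ...   | yes _   = charMatrix-diagonal p≡q
      ...   | no  q≰p = contradiction (ℕ.≤-reflexive (≡.sym p≡q)) q≰p
      xI-J≈charMatrix n p q | no p≢q with toℕ q ℕ.≤? toℕ p
      ...   | yes q≤p = charMatrix-below (ℕ.≤∧≢⇒< q≤p (p≢q ∘ ≡.sym))
      ...   | no  q≰p with toℕ q ℕ.≟ suc (toℕ p)
      ...     | yes q≡p+1 = charMatrix-superdiagonal q≡p+1
      ...     | no  q≢p+1 = trans -0#≈0# (sym (toeplitzHessenberg-isLowerHessenberg charColumn 0 (toℕ p) (toℕ q)
                                                   (ℕ.≤∧≢⇒< (ℕ.≰⇒> q≰p) (q≢p+1 ∘ ≡.sym))))

      charPoly≈leadingMinor : ∀ n → charPolyAt R n (Jmat R j n) x ≈ leadingMinor charMatrix n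
      charPoly≈leadingMinor n = det-cong n (xI-J≈charMatrix n)

      newtonWeight : ℕ → ℕ → Carrier
      newtonWeight l d = −1^ d * ι (rising l d) * j (suc d)

      CharRecurrence : (ℕ → Carrier) → Set ℓ
      CharRecurrence F = ∀ m → F (suc m) + ∑ (λ l → F l * newtonWeight l (m ∸ l)) (suc m) ≈ x * F m

      CharRecurrence-unique : ∀ {F G} → CharRecurrence F → CharRecurrence G → F 0 ≈ G 0 → ∀ n → F n ≈ G n
      CharRecurrence-unique {F} {G} recF recG F₀≈G₀ = <-rec _ step
        where
        step : ∀ n → (∀ {l} → l < n → F l ≈ G l) → F n ≈ G n
        step zero    _  = F₀≈G₀
        step (suc m) ih = +-cancelʳ (tail G) (F (suc m)) (G (suc m)) (begin
          F (suc m) + tail G ≈⟨ +-congˡ (∑-cong (suc m) (λ l l≤m → *-congʳ (ih l≤m))) ⟨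
          F (suc m) + tail F ≈⟨ recF m ⟩
          x * F m            ≈⟨ *-congˡ (ih ℕ.≤-refl) ⟩
          x * G m            ≈⟨ recG m ⟨
          G (suc m) + tail G ∎)
          where
          tail : (ℕ → Carrier) → Carrier
          tail H = ∑ (λ l → H l * newtonWeight l (m ∸ l)) (suc m)

      lastRow⇒CharRecurrence : ∀ {F} →
        (∀ m → F (suc m) ≈ ∑ (λ l → F l * (−1^ (m ∸ l) * ι (rising l (m ∸ l)) * charColumn (m ∸ l))) (suc m)) →
        CharRecurrence F
      lastRow⇒CharRecurrence {F} lastRow m = begin
        F (suc m) + ∑ (λ l → F l * newtonWeight l (m ∸ l)) (suc m)
          ≈⟨ +-congʳ (lastRow m) ⟩
        ∑ (λ l → F l * (weight l * charColumn (m ∸ l))) (suc m) + ∑ (λ l → F l * (weight l * j (suc (m ∸ l)))) (suc m)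
          ≈⟨ ∑-distrib-+ (suc m) _ _ ⟨
        ∑ (λ l → F l * (weight l * charColumn (m ∸ l)) + F l * (weight l * j (suc (m ∸ l)))) (suc m)
          ≈⟨ ∑-cong (suc m) (λ l _ → recombine (F l) (weight l) (diagonal (m ∸ l)) (j (suc (m ∸ l)))) ⟩
        ∑ (λ l → F l * (weight l * diagonal (m ∸ l))) m + F m * (weight m * diagonal (m ∸ m))
          ≈⟨ +-cong (∑-zero m (λ l l<m → off-diagonal l<m)) on-diagonal ⟩
        0# + x * F m
          ≈⟨ +-identityˡ _ ⟩
        x * F m ∎
        where
        weight : ℕ → Carrier
        weight l = −1^ (m ∸ l) * ι (rising l (m ∸ l))

        recombine : ∀ f w y z → f * (w * (y - z)) + f * (w * z) ≈ f * (w * y)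
        recombine f w y z = begin
          f * (w * (y - z)) + f * (w * z) ≈⟨ distribˡ f _ _ ⟨
          f * (w * (y - z) + w * z)       ≈⟨ *-congˡ (distribˡ w _ _) ⟨
          f * (w * ((y - z) + z))         ≈⟨ *-congˡ (*-congˡ (trans (+-assoc y (- z) z) (+-congˡ (-‿inverseˡ z)))) ⟩
          f * (w * (y + 0#))              ≈⟨ *-congˡ (*-congˡ (+-identityʳ y)) ⟩
          f * (w * y)                     ∎

        diagonal-vanishes : ∀ {l n} → l < n → diagonal (n ∸ l) ≡ 0#
        diagonal-vanishes {zero}  {suc n} _         = ≡.refl
        diagonal-vanishes {suc l} {suc n} (s≤s l<n) = diagonal-vanishes l<n

        off-diagonal : ∀ {l} → l < m → F l * (weight l * diagonal (m ∸ l)) ≈ 0#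
        off-diagonal l<m rewrite diagonal-vanishes l<m = trans (*-congˡ (zeroʳ _)) (zeroʳ _)

        on-diagonal : F m * (weight m * diagonal (m ∸ m)) ≈ x * F m
        on-diagonal rewrite ℕ.n∸n≡0 m =
          trans (*-congˡ (trans (*-congʳ (trans (*-identityˡ _) (+-identityʳ 1#))) (*-identityˡ x))) (*-comm _ x)

      leadingMinor-charMatrix-recurrence : CharRecurrence (leadingMinor charMatrix)
      leadingMinor-charMatrix-recurrence = lastRow⇒CharRecurrence (toeplitzHessenberg-lastRowExpansion charColumn)

      module _ (h : ℕ → Carrier) where

        ∑≈rhsPoly*newtonWeight : ∀ l t →
          ∑ (λ p → j (suc t) * h p * (−1^ (t ℕ.+ p) * powDerivative (l ℕ.+ t) (t ℕ.+ p))) (suc l)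
            ≈ rhsPoly h l * newtonWeight l t
        ∑≈rhsPoly*newtonWeight l t = begin
          ∑ (λ p → j (suc t) * h p * (−1^ (t ℕ.+ p) * powDerivative (l ℕ.+ t) (t ℕ.+ p))) (suc l)
            ≈⟨ ∑-cong (suc l) (λ p _ → *-congˡ (*-cong (−1^-+ t p) (powDerivative-+ l t p))) ⟩
          ∑ (λ p → j (suc t) * h p * (−1^ t * −1^ p * (ι (rising l t) * powDerivative l p))) (suc l)
            ≈⟨ ∑-cong (suc l) (λ p _ →
                 rearrange (j (suc t)) (h p) (−1^ t) (−1^ p) (ι (rising l t)) (powDerivative l p)) ⟩
          ∑ (λ p → newtonWeight l t * rhsTerm h l p) (suc l)
            ≈⟨ *-distribˡ-∑ (suc l) _ _ ⟨
          newtonWeight l t * rhsPoly h l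
            ≈⟨ *-comm _ _ ⟩
          rhsPoly h l * newtonWeight l t ∎
          where
          rearrange : ∀ J H T P r D → J * H * (T * P * (r * D)) ≈ T * r * J * (H * (P * D))
          rearrange = solve 6 (λ J H T P r D → J :* H :* (T :* P :* (r :* D)) := T :* r :* J :* (H :* (P :* D))) refl

        rhsPoly-newton : NewtonRel R h j → ∀ m →
          ∑ (λ s → ι (suc s) * h (suc s) * (−1^ s * powDerivative m s)) (suc m)
            ≈ ∑ (λ l → rhsPoly h l * newtonWeight l (m ∸ l)) (suc m)
        rhsPoly-newton newton m = begin
          ∑ (λ s → ι (suc s) * h (suc s) * (−1^ s * powDerivative m s)) (suc m)
            ≈⟨ ∑-cong (suc m) (λ s _ → *-congʳ (newton s)) ⟩
          ∑ (λ s → ∑ (λ t → j (suc t) * h (s ∸ t)) (suc s) * (−1^ s * powDerivative m s)) (suc m)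
            ≈⟨ ∑-cong (suc m) (λ s _ → *-distribʳ-∑ (suc s) _ _) ⟩
          ∑ (λ s → ∑ (λ t → j (suc t) * h (s ∸ t) * (−1^ s * powDerivative m s)) (suc s)) (suc m)
            ≈⟨ ∑-cong (suc m) (λ s _ → ∑-cong (suc s) (λ t t≤s →
                 reflexive (≡.cong (λ n → j (suc t) * h (s ∸ t) * (−1^ n * powDerivative m n))
                                   (≡.sym (ℕ.m+[n∸m]≡n (ℕ.≤-pred t≤s)))))) ⟩
          ∑ (λ s → ∑ (λ t → G t (s ∸ t)) (suc s)) (suc m)
            ≈⟨ ∑-antidiagonal (suc m) G ⟨
          ∑ (λ t → ∑ (G t) (suc m ∸ t)) (suc m)
            ≈⟨ ∑-cong (suc m) (λ t t≤m → inner (ℕ.≤-pred t≤m)) ⟩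
          ∑ (λ t → rhsPoly h (m ∸ t) * newtonWeight (m ∸ t) t) (suc m)
            ≈⟨ ∑-cong (suc m) (λ t t≤m →
                 *-congˡ (reflexive (≡.cong (newtonWeight (m ∸ t)) (≡.sym (ℕ.m∸[m∸n]≡n (ℕ.≤-pred t≤m)))))) ⟩
          ∑ (λ t → rhsPoly h (m ∸ t) * newtonWeight (m ∸ t) (m ∸ (m ∸ t))) (suc m)
            ≈⟨ ∑-reverse (suc m) _ ⟨
          ∑ (λ l → rhsPoly h l * newtonWeight l (m ∸ l)) (suc m) ∎
          where
          G : ℕ → ℕ → Carrier
          G t p = j (suc t) * h p * (−1^ (t ℕ.+ p) * powDerivative m (t ℕ.+ p))

          inner : ∀ {t} → t ≤ m → ∑ (G t) (suc m ∸ t) ≈ rhsPoly h (m ∸ t) * newtonWeight (m ∸ t) t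
          inner {t} t≤m = begin
            ∑ (G t) (suc m ∸ t)
              ≡⟨ ≡.cong (∑ (G t)) (ℕ.+-∸-assoc 1 t≤m) ⟩
            ∑ (G t) (suc (m ∸ t))
              ≡⟨ ≡.cong (λ n → ∑ (λ p → j (suc t) * h p * (−1^ (t ℕ.+ p) * powDerivative n (t ℕ.+ p)))
                                 (suc (m ∸ t)))
                        (≡.sym (ℕ.m∸n+n≡m t≤m)) ⟩
            ∑ (λ p → j (suc t) * h p * (−1^ (t ℕ.+ p) * powDerivative (m ∸ t ℕ.+ t) (t ℕ.+ p))) (suc (m ∸ t))
              ≈⟨ ∑≈rhsPoly*newtonWeight (m ∸ t) t ⟩
            rhsPoly h (m ∸ t) * newtonWeight (m ∸ t) t ∎

        rhsPoly-recurrence : NewtonRel R h j → CharRecurrence (rhsPoly h)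
        rhsPoly-recurrence newton m = trans (+-congˡ (sym (rhsPoly-newton newton m))) (rhsPoly-pascal h m)

theorem2p3 : ∀ {c ℓ} (R : CommutativeRing c ℓ) →
    let open CommutativeRing R in
    (h j : ℕ → Carrier) → h 0 ≈ 1# → NewtonRel R h j →
    (n : ℕ) → (x : Carrier) →
    charPolyAt R (suc n) (Jmat R j (suc n)) x ≈ rhs R h (suc n) x
theorem2p3 R h j h₀≈1 newton n x = begin
  charPolyAt R (suc n) (Jmat R j (suc n)) x ≈⟨ charPoly≈leadingMinor R x j (suc n) ⟩
  leadingMinor R (charMatrix R x j) (suc n)
    ≈⟨ CharRecurrence-unique R x j (leadingMinor-charMatrix-recurrence R x j) (rhsPoly-recurrence R x j h newton)
                                   (sym (rhsPoly-zero R x h h₀≈1)) (suc n) ⟩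
  rhsPoly R x h (suc n)                     ≈⟨ rhs≈rhsPoly R x h (suc n) ⟨
  rhs R h (suc n) x                         ∎
  where
  open CommutativeRing R
  open import Relation.Binary.Reasoning.Setoid setoid
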